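{- Let $(\pi_{i,j},k_i,l_j)$, $0\le i\le m$, $0\le j\le n$, be a $k$-growth diagram such that $k_1\le k_2\le\cdots\le k_m$, $l_1\ge l_2\ge\cdots\ge l_n$, and $l_1\le k_1$. Then for each $1\le j\le n$, $l_j\le d_1(\pi_{i,j-1})$ for all $i$, and for each $1\le i\le m$, $k_i\ge d_2(\pi_{i-1,j})$ for all $j$.
   Context: Permutations are in one-line notation; $\ell$ is Coxeter length; $\pi t_{ab}$ is $\pi$ with the entries in positions $a,b$ swapped. We write $\rho\lessdot_k\pi$ (or $\pi\gtrdot_k\rho$) if $\pi=\rho t_{ab}$ for some $a\le k<b$ and $\ell(\pi)=\ell(\rho)+1$. A descent of $\pi$ is an $i$ with $\pi(i)>\pi(i+1)$; for $\pi\ne\mathrm{id}$, $d_1(\pi)$ and $d_2(\pi)$ denote its first and last descent positions; an inequality involving $d_1$ or $d_2$ of the identity permutation is regarded as vacuous. A $k$-growth diagram is a matrix of permutations $\pi_{i,j}$ ($0\le i\le m$, $0\le j\le n$) with positive integers $k_i$ ($1\le i\le m$), $l_j$ ($1\le j\le n$) such that: (a) $\pi_{0,0}=\mathrm{id}$; (b) $\pi_{i,j}\gtrdot_{k_i}\pi_{i-1,j}$ for all $i\ge1$ and all $j$; (c) $\pi_{i,j}\gtrdot_{l_j}\pi_{i,j-1}$ for all $j\ge1$ and all $i$; (d) for each square, if $x$ is the unique permutation in the open Bruhat interval $(\pi_{i-1,j-1},\pi_{i,j})$ different from $\pi_{i,j-1}$ and $x\lessdot_{k_i}\pi_{i,j}$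 and $x\gtrdot_{l_j}\pi_{i-1,j-1}$, then $\pi_{i-1,j}=x$; if no such $x$ exists, $\pi_{i-1,j}=\pi_{i,j-1}$. -}

module Defs where

open import Data.Nat using (ℕ; zero; suc; _+_; _≤_; _<_; _<ᵇ_)
open import Data.Nat.Properties using (_<?_)
open import Data.Fin using (Fin; toℕ)
open import Data.Vec using (Vec; lookup; tabulate; toList; _[_]≔_)
open import Data.List as List using (List; []; _∷_; length; filter; head; last)
open import Data.Bool using (if_then_else_)
open import Data.Maybe using (Maybe; just)
open import Data.Product using (Σ; ∃; _×_; _,_)
open import Relation.Binary.PropositionalEquality using (_≡_; _≢_)
open import Relation.Binary.Construct.Closure.ReflexiveTransitive using (Star)
open import Relation.Nullary using (¬_)

-- A permutation of [N] = {1,…,N} in one-line notation: the vector (π(1),…,π(N)).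
-- (Every vector occurring below is obtained from the identity by transpositions,
-- hence is a genuine permutation.)
Perm : ℕ → Set
Perm N = Vec ℕ N

idPerm : (N : ℕ) → Perm N
idPerm N = tabulate (λ i → suc (toℕ i))

-- Coxeter length = number of inversions.
invList : List ℕ → ℕ
invList []       = 0
invList (x ∷ xs) = length (filter (_<? x) xs) + invList xs

ℓ : {N : ℕ} → Perm N → ℕ
ℓ π = invList (toList π)

-- π t_{ab}: swap the entries in positions a and b (positions given 0-based as Fin N;
-- the 1-based position is suc (toℕ a)).
swapPos : {N : ℕ} → Perm N → Fin N → Fin N → Perm N
swapPos π a b = (π [ a ]≔ lookup π b) [ b ]≔ lookup π a

Cov : {N : ℕ} → ℕ → Perm N → Perm N → Set
Cov {N} k ρ π = Σ (Fin N) λ a → Σ (Fin N) λ b →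
  (suc (toℕ a) ≤ k) × (k < suc (toℕ b)) × (π ≡ swapPos ρ a b) × (ℓ π ≡ suc (ℓ ρ))

BruhatStep : {N : ℕ} → Perm N → Perm N → Set
BruhatStep {N} ρ π = Σ (Fin N) λ a → Σ (Fin N) λ b → (π ≡ swapPos ρ a b) × (ℓ ρ < ℓ π)

_≤B_ : {N : ℕ} → Perm N → Perm N → Set
_≤B_ = Star BruhatStep

InOpen : {N : ℕ} → Perm N → Perm N → Perm N → Set
InOpen ρ π x = (ρ ≤B x) × (x ≤B π) × (x ≢ ρ) × (x ≢ π)

-- Descent positions (1-based), in increasing order.
descFrom : ℕ → List ℕ → List ℕ
descFrom i []           = []
descFrom i (x ∷ [])     = []
descFrom i (x ∷ y ∷ ys) =
  if y <ᵇ x then i ∷ descFrom (suc i) (y ∷ ys) else descFrom (suc i) (y ∷ ys)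

descents : {N : ℕ} → Perm N → List ℕ
descents π = descFrom 1 (toList π)

d₁ : {N : ℕ} → Perm N → Maybe ℕ
d₁ π = head (descents π)

d₂ : {N : ℕ} → Perm N → Maybe ℕ
d₂ π = last (descents π)

-- "l ≤ d₁(π)" and "k ≥ d₂(π)", vacuous for the identity
_≤d₁_ : {N : ℕ} → ℕ → Perm N → Set
l ≤d₁ π = ∀ d → d₁ π ≡ just d → l ≤ d

_≥d₂_ : {N : ℕ} → ℕ → Perm N → Set
k ≥d₂ π = ∀ d → d₂ π ≡ just d → d ≤ k

-- Local rule (d) for the square  ρ = π_{i-1,j-1}, σ = π_{i,j-1}, τ = π_{i-1,j}, top = π_{i,j},
-- with ki = k_i, lj = l_j.
LocalRule : {N : ℕ} → ℕ → ℕ → Perm N → Perm N → Perm N → Perm N → Set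
LocalRule ki lj ρ σ τ top =
  (∀ x → InOpen ρ top x → x ≢ σ → Cov ki x top → Cov lj ρ x → τ ≡ x)
  × (¬ (∃ λ x → InOpen ρ top x × x ≢ σ × Cov ki x top × Cov lj ρ x) → τ ≡ σ)

-- A k-growth diagram (π_{i,j}, k_i, l_j), 0 ≤ i ≤ m, 0 ≤ j ≤ n, of permutations of [N].
-- Values of π, k, l outside the index ranges are irrelevant.
record GrowthDiagram (N m n : ℕ) : Set where
  field
    π     : ℕ → ℕ → Perm N
    k     : ℕ → ℕ
    l     : ℕ → ℕ
    k-pos : ∀ i → 1 ≤ i → i ≤ m → 1 ≤ k i
    l-pos : ∀ j → 1 ≤ j → j ≤ n → 1 ≤ l j
    origin : π 0 0 ≡ idPerm N
    vert  : ∀ i j → suc i ≤ m → j ≤ n → Cov (k (suc i)) (π i j) (π (suc i) j)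
    horiz : ∀ i j → i ≤ m → suc j ≤ n → Cov (l (suc j)) (π i j) (π i (suc j))
    local : ∀ i j → suc i ≤ m → suc j ≤ n →
      LocalRule (k (suc i)) (l (suc j)) (π i j) (π (suc i) j) (π i (suc j)) (π (suc i) (suc j))

-- A cover ρ ⋖ₖ ρ t_{ab} (a ≤ k < b) raises the inversion count by exactly one; counting
-- inversions shows this forces ρ(a) < ρ(b) with no entry strictly between positions a and b
-- taking a value between ρ(a) and ρ(b). Such a transposition creates no descent except at
-- position a = k when b = a + 1, so every descent of π is a descent of ρ or the label k.
-- Following row 0 and then column j from π₀₀ = id (which has no descents), the descents of
-- π_{i,j} are therefore among the labels l₁,…,l_j, k₁,…,k_i, and the monotonicity hypotheses
-- bound those from below by l_{j+1} and from above by k_{i+1}.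
module Submission where

open import Defs
open import Data.Bool using (true; false; if_then_else_)
open import Data.Fin using (Fin; toℕ) renaming (zero to fzero; suc to fsuc)
open import Data.List using (List; []; _∷_; _++_; length; filter)
open import Data.List.Properties using (filter-accept; filter-reject)
open import Data.List.Relation.Unary.All as All using (All; []; _∷_)
open import Data.List.Relation.Unary.All.Properties using (head⁺; last⁺)
open import Data.List.Relation.Unary.Linked using (Linked; []; [-]; _∷_)
open import Data.Maybe using (just)
import Data.Maybe.Relation.Unary.All as Maybe
open import Data.Nat using (ℕ; zero; suc; _+_; _≤_; _<_; _<ᵇ_; z≤n; s≤s; s≤s⁻¹)
open import Data.Nat.Properties
open import Data.Nat.Solver using (module +-*-Solver)
open import Data.Product using (_×_; _,_; Σ; proj₁; proj₂)
open import Data.Sum using (_⊎_; inj₁; inj₂)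
open import Data.Unit using (⊤; tt)
open import Data.Vec using (Vec; lookup; toList; tabulate; _[_]≔_) renaming (_∷_ to _∷ᵥ_)
open import Function using (_∘_; flip)
open import Relation.Binary.Core using (Rel)
open import Relation.Binary.Definitions using (Reflexive; Transitive)
open import Relation.Binary.PropositionalEquality
open import Relation.Nullary using (¬_; yes; no; does; contradiction; ofʸ)
open import Relation.Nullary.Decidable using (dec-true; dec-false)

open +-*-Solver

ind< : ℕ → ℕ → ℕ
ind< a b = if does (a <? b) then 1 else 0

ind<-yes : ∀ {a b} → a < b → ind< a b ≡ 1
ind<-yes {a} {b} a<b = cong (if_then 1 else 0) (dec-true (a <? b) a<b)

ind<-no : ∀ {a b} → ¬ a < b → ind< a b ≡ 0
ind<-no {a} {b} a≮b = cong (if_then 1 else 0) (dec-false (a <? b) a≮b)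

ind<-monoʳ : ∀ a {b c} → b ≤ c → ind< a b ≤ ind< a c
ind<-monoʳ a {b} {c} b≤c with a <? b
... | yes a<b = ≤-reflexive (trans (ind<-yes a<b) (sym (ind<-yes (<-≤-trans a<b b≤c))))
... | no a≮b = subst (_≤ ind< a c) (sym (ind<-no a≮b)) z≤n

ind<-antitoneˡ : ∀ {a b} c → a ≤ b → ind< b c ≤ ind< a c
ind<-antitoneˡ {a} {b} c a≤b with b <? c
... | yes b<c = ≤-reflexive (trans (ind<-yes b<c) (sym (ind<-yes (≤-<-trans a≤b b<c))))
... | no b≮c = subst (_≤ ind< a c) (sym (ind<-no b≮c)) z≤n

sumBy : (ℕ → ℕ) → List ℕ → ℕ
sumBy f []       = 0
sumBy f (z ∷ zs) = f z + sumBy f zs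

module _ {f : ℕ → ℕ} where

  sumBy-++ : ∀ xs ys → sumBy f (xs ++ ys) ≡ sumBy f xs + sumBy f ys
  sumBy-++ []       ys = refl
  sumBy-++ (x ∷ xs) ys = trans (cong (f x +_) (sumBy-++ xs ys)) (sym (+-assoc (f x) _ _))

  sumBy-swap : ∀ x M y S → sumBy f (x ∷ M ++ y ∷ S) ≡ sumBy f (y ∷ M ++ x ∷ S)
  sumBy-swap x M y S = begin
      f x + sumBy f (M ++ y ∷ S)
    ≡⟨ cong (f x +_) (sumBy-++ M (y ∷ S)) ⟩
      f x + (sumBy f M + (f y + sumBy f S))
    ≡⟨ solve 4 (λ a b c d → a :+ (b :+ (c :+ d)) := c :+ (b :+ (a :+ d))) refl
         (f x) (sumBy f M) (f y) (sumBy f S) ⟩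
      f y + (sumBy f M + (f x + sumBy f S))
    ≡⟨ cong (f y +_) (sym (sumBy-++ M (x ∷ S))) ⟩
      f y + sumBy f (M ++ x ∷ S)
    ∎ where open ≡-Reasoning

module _ {f g : ℕ → ℕ} where

  sumBy-+ : ∀ xs → sumBy (λ z → f z + g z) xs ≡ sumBy f xs + sumBy g xs
  sumBy-+ []       = refl
  sumBy-+ (x ∷ xs) = begin
      (f x + g x) + sumBy (λ z → f z + g z) xs
    ≡⟨ cong ((f x + g x) +_) (sumBy-+ xs) ⟩
      (f x + g x) + (sumBy f xs + sumBy g xs)
    ≡⟨ solve 4 (λ a b c d → (a :+ b) :+ (c :+ d) := (a :+ c) :+ (b :+ d)) refl
         (f x) (g x) (sumBy f xs) (sumBy g xs) ⟩
      (f x + sumBy f xs) + (g x + sumBy g xs)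
    ∎ where open ≡-Reasoning

  sumBy-cong : (∀ z → f z ≡ g z) → ∀ xs → sumBy f xs ≡ sumBy g xs
  sumBy-cong f≡g []       = refl
  sumBy-cong f≡g (x ∷ xs) = cong₂ _+_ (f≡g x) (sumBy-cong f≡g xs)

  sumBy-mono : (∀ z → f z ≤ g z) → ∀ xs → sumBy f xs ≤ sumBy g xs
  sumBy-mono f≤g []       = z≤n
  sumBy-mono f≤g (x ∷ xs) = +-mono-≤ (f≤g x) (sumBy-mono f≤g xs)

  sumBy-mono-≡⇒All≡ : (∀ z → f z ≤ g z) → ∀ xs →
    sumBy f xs ≡ sumBy g xs → All (λ z → f z ≡ g z) xs
  sumBy-mono-≡⇒All≡ f≤g []       _ = []
  sumBy-mono-≡⇒All≡ f≤g (x ∷ xs) e =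
    fx≡gx ∷ sumBy-mono-≡⇒All≡ f≤g xs
      (+-cancelˡ-≡ (f x) _ _ (trans e (cong (_+ sumBy g xs) (sym fx≡gx))))
    where
    fx≡gx : f x ≡ g x
    fx≡gx = ≤∧≮⇒≡ (f≤g x) λ fx<gx → <-irrefl e (+-mono-<-≤ fx<gx (sumBy-mono f≤g xs))

below : ℕ → List ℕ → ℕ
below p = sumBy (λ z → ind< z p)

length-filter-< : ∀ p xs → length (filter (_<? p) xs) ≡ below p xs
length-filter-< p []       = refl
length-filter-< p (z ∷ zs) with z <? p
... | yes z<p = begin
    length (filter (_<? p) (z ∷ zs))  ≡⟨ cong length (filter-accept (_<? p) z<p) ⟩
    suc (length (filter (_<? p) zs))  ≡⟨ cong suc (length-filter-< p zs) ⟩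
    suc (below p zs)                  ≡⟨ cong (_+ below p zs) (sym (ind<-yes z<p)) ⟩
    below p (z ∷ zs)                  ∎ where open ≡-Reasoning
... | no z≮p = begin
    length (filter (_<? p) (z ∷ zs))  ≡⟨ cong length (filter-reject (_<? p) z≮p) ⟩
    length (filter (_<? p) zs)        ≡⟨ length-filter-< p zs ⟩
    below p zs                        ≡⟨ cong (_+ below p zs) (sym (ind<-no z≮p)) ⟩
    below p (z ∷ zs)                  ∎ where open ≡-Reasoning

invList-∷ : ∀ x xs → invList (x ∷ xs) ≡ below x xs + invList xs
invList-∷ x xs = cong (_+ invList xs) (length-filter-< x xs)

crossInv : List ℕ → List ℕ → ℕ
crossInv P R = sumBy (λ p → below p R) P

invList-++ : ∀ P R → invList (P ++ R) ≡ invList P + crossInv P R + invList R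
invList-++ []      R = refl
invList-++ (p ∷ P) R = begin
    invList (p ∷ P ++ R)
  ≡⟨ invList-∷ p (P ++ R) ⟩
    below p (P ++ R) + invList (P ++ R)
  ≡⟨ cong₂ _+_ (sumBy-++ P R) (invList-++ P R) ⟩
    (below p P + below p R) + (invList P + crossInv P R + invList R)
  ≡⟨ solve 5 (λ a b c d e → (a :+ b) :+ (c :+ d :+ e) := (a :+ c) :+ (b :+ d) :+ e) refl
       (below p P) (below p R) (invList P) (crossInv P R) (invList R) ⟩
    (below p P + invList P) + (below p R + crossInv P R) + invList R
  ≡⟨ cong (λ z → z + (below p R + crossInv P R) + invList R) (sym (invList-∷ p P)) ⟩
    invList (p ∷ P) + crossInv (p ∷ P) R + invList R
  ∎ where open ≡-Reasoning

pairInv : ℕ → ℕ → ℕ → ℕ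
pairInv x y m = ind< m x + ind< y m

restInv : ℕ → ℕ → List ℕ → List ℕ → ℕ
restInv x y M S = (below x S + below y S) + (invList M + crossInv M S + invList S)

restInv-comm : ∀ x y M S → restInv x y M S ≡ restInv y x M S
restInv-comm x y M S =
  cong (_+ (invList M + crossInv M S + invList S)) (+-comm (below x S) (below y S))

invList-pair : ∀ x M y S →
  invList (x ∷ M ++ y ∷ S) ≡ restInv x y M S + (ind< y x + sumBy (pairInv x y) M)
invList-pair x M y S = begin
    invList (x ∷ M ++ y ∷ S)
  ≡⟨ invList-∷ x (M ++ y ∷ S) ⟩
    below x (M ++ y ∷ S) + invList (M ++ y ∷ S)
  ≡⟨ cong₂ _+_ (sumBy-++ M (y ∷ S)) (invList-++ M (y ∷ S)) ⟩
    (below x M + (ind< y x + below x S)) + (invList M + crossInv M (y ∷ S) + invList (y ∷ S))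
  ≡⟨ cong₂ (λ c i → (below x M + (ind< y x + below x S)) + (invList M + c + i))
       (sumBy-+ M) (invList-∷ y S) ⟩
    (below x M + (ind< y x + below x S))
      + (invList M + (sumBy (ind< y) M + crossInv M S) + (below y S + invList S))
  ≡⟨ solve 8 (λ a b c d e f g h →
        (a :+ (b :+ c)) :+ (d :+ (e :+ f) :+ (g :+ h)) := ((c :+ g) :+ (d :+ f :+ h)) :+ (b :+ (a :+ e)))
        refl (below x M) (ind< y x) (below x S) (invList M) (sumBy (ind< y) M) (crossInv M S)
        (below y S) (invList S) ⟩
    restInv x y M S + (ind< y x + (below x M + sumBy (ind< y) M))
  ≡⟨ cong (λ z → restInv x y M S + (ind< y x + z)) (sym (sumBy-+ M)) ⟩
    restInv x y M S + (ind< y x + sumBy (pairInv x y) M)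
  ∎ where open ≡-Reasoning

Outside : ℕ → ℕ → ℕ → Set
Outside x y m = m < x ⊎ y < m

pairInv-mono : ∀ {x y} → x ≤ y → ∀ m → pairInv x y m ≤ pairInv y x m
pairInv-mono x≤y m = +-mono-≤ (ind<-monoʳ m x≤y) (ind<-antitoneˡ m x≤y)

pairInv-≡⇒Outside : ∀ {x y} → x < y → ∀ {m} → pairInv x y m ≡ pairInv y x m → Outside x y m
pairInv-≡⇒Outside {x} {y} x<y {m} e with m <? x | y <? m
... | yes m<x | _       = inj₁ m<x
... | no _    | yes y<m = inj₂ y<m
... | no m≮x  | no y≮m  = contradiction (trans (sym e) unmoved) (m<n⇒n≢0 moved)
  where
  unmoved : pairInv x y m ≡ 0
  unmoved rewrite ind<-no m≮x | ind<-no y≮m = refl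
  moved : 0 < pairInv y x m
  moved with x <? m
  ... | yes x<m rewrite ind<-yes x<m = m≤n+m 1 (ind< m y)
  ... | no x≮m rewrite ind<-yes (≤-<-trans (≮⇒≥ x≮m) x<y) = s≤s z≤n

pairWeight-suc⇒Outside : ∀ {x y} M →
  ind< x y + sumBy (pairInv y x) M ≡ suc (ind< y x + sumBy (pairInv x y) M) →
  x < y × All (Outside x y) M
pairWeight-suc⇒Outside {x} {y} M e with x <? y
... | no x≮y = contradiction e (<⇒≢ (s≤s (begin
    ind< x y + sumBy (pairInv y x) M  ≡⟨ cong (_+ sumBy (pairInv y x) M) (ind<-no x≮y) ⟩
    sumBy (pairInv y x) M             ≤⟨ sumBy-mono (pairInv-mono (≮⇒≥ x≮y)) M ⟩
    sumBy (pairInv x y) M             ≤⟨ m≤n+m _ (ind< y x) ⟩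
    ind< y x + sumBy (pairInv x y) M  ∎)))
  where open ≤-Reasoning
... | yes x<y = x<y , All.map (pairInv-≡⇒Outside x<y)
    (sumBy-mono-≡⇒All≡ (pairInv-mono (<⇒≤ x<y)) M (sym (suc-injective (begin
      suc (sumBy (pairInv y x) M)
    ≡⟨ cong (_+ sumBy (pairInv y x) M) (sym (ind<-yes x<y)) ⟩
      ind< x y + sumBy (pairInv y x) M
    ≡⟨ e ⟩
      suc (ind< y x + sumBy (pairInv x y) M)
    ≡⟨ cong (λ z → suc (z + sumBy (pairInv x y) M)) (ind<-no (<-asym x<y)) ⟩
      suc (sumBy (pairInv x y) M)
    ∎))))
  where open ≡-Reasoning

-- Swapping x and y changes the inversion count by [x < y] − [y < x] plus, for each m in
-- between, pairInv y x m − pairInv x y m, which is positive exactly when x ≤ m ≤ y. A change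
-- of exactly one therefore forces x < y and every such m outside [x, y].
transposition-cover : ∀ P x M y S →
  invList (P ++ y ∷ M ++ x ∷ S) ≡ suc (invList (P ++ x ∷ M ++ y ∷ S)) →
  x < y × All (Outside x y) M
transposition-cover P x M y S e =
  pairWeight-suc⇒Outside M (+-cancelˡ-≡ (restInv x y M S) _ _ (begin
    restInv x y M S + (ind< x y + sumBy (pairInv y x) M)
  ≡⟨ cong (_+ (ind< x y + sumBy (pairInv y x) M)) (restInv-comm x y M S) ⟩
    restInv y x M S + (ind< x y + sumBy (pairInv y x) M)
  ≡⟨ sym (invList-pair y M x S) ⟩
    invList R′
  ≡⟨ +-cancelˡ-≡ (invList P + crossInv P R) _ _ prefixed ⟩
    suc (invList R)
  ≡⟨ cong suc (invList-pair x M y S) ⟩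
    suc (restInv x y M S + (ind< y x + sumBy (pairInv x y) M))
  ≡⟨ sym (+-suc _ _) ⟩
    restInv x y M S + suc (ind< y x + sumBy (pairInv x y) M)
  ∎))
  where
  open ≡-Reasoning
  R R′ : List ℕ
  R  = x ∷ M ++ y ∷ S
  R′ = y ∷ M ++ x ∷ S
  prefixed : invList P + crossInv P R + invList R′ ≡ invList P + crossInv P R + suc (invList R)
  prefixed = begin
      invList P + crossInv P R + invList R′
    ≡⟨ cong (λ c → invList P + c + invList R′) (sumBy-cong (λ p → sumBy-swap x M y S) P) ⟩
      invList P + crossInv P R′ + invList R′
    ≡⟨ sym (invList-++ P R′) ⟩
      invList (P ++ R′)
    ≡⟨ e ⟩
      suc (invList (P ++ R))
    ≡⟨ cong suc (invList-++ P R) ⟩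
      suc (invList P + crossInv P R + invList R)
    ≡⟨ sym (+-suc _ _) ⟩
      invList P + crossInv P R + suc (invList R)
    ∎

AllDescentsFrom : (ℕ → Set) → ℕ → List ℕ → Set
AllDescentsFrom Q i []           = ⊤
AllDescentsFrom Q i (x ∷ [])     = ⊤
AllDescentsFrom Q i (x ∷ y ∷ ys) = (y < x → Q i) × AllDescentsFrom Q (suc i) (y ∷ ys)

AllDescents : (ℕ → Set) → ∀ {N} → Perm N → Set
AllDescents Q π = AllDescentsFrom Q 1 (toList π)

module _ {Q : ℕ → Set} where

  allDescentsFrom⇒All : ∀ i xs → AllDescentsFrom Q i xs → All Q (descFrom i xs)
  allDescentsFrom⇒All i []           _        = []
  allDescentsFrom⇒All i (x ∷ [])     _        = []
  allDescentsFrom⇒All i (x ∷ y ∷ ys) (d , ds)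
    with y <ᵇ x | <ᵇ-reflects-< y x | allDescentsFrom⇒All (suc i) (y ∷ ys) ds
  ... | true  | ofʸ y<x | rest = d y<x ∷ rest
  ... | false | _       | rest = rest

  allDescentsFrom-lowerHead : ∀ {i x y} S → x ≤ y →
    AllDescentsFrom Q i (y ∷ S) → AllDescentsFrom Q i (x ∷ S)
  allDescentsFrom-lowerHead []      x≤y _        = tt
  allDescentsFrom-lowerHead (s ∷ S) x≤y (d , ds) = (λ s<x → d (<-≤-trans s<x x≤y)) , ds

  allDescentsFrom-lowerAfter : ∀ {i x y S} M → All (Outside x y) M → x ≤ y →
    AllDescentsFrom Q i (M ++ y ∷ S) → AllDescentsFrom Q i (M ++ x ∷ S)
  allDescentsFrom-lowerAfter {S = S} [] [] x≤y ds = allDescentsFrom-lowerHead S x≤y ds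
  allDescentsFrom-lowerAfter {S = S} (m ∷ []) (inj₁ m<x ∷ []) x≤y (d , ds) =
    (λ x<m → contradiction m<x (<-asym x<m)) , allDescentsFrom-lowerHead S x≤y ds
  allDescentsFrom-lowerAfter {S = S} (m ∷ []) (inj₂ y<m ∷ []) x≤y (d , ds) =
    (λ _ → d y<m) , allDescentsFrom-lowerHead S x≤y ds
  allDescentsFrom-lowerAfter (m ∷ m′ ∷ M) (_ ∷ os) x≤y (d , ds) =
    d , allDescentsFrom-lowerAfter (m′ ∷ M) os x≤y ds

  allDescentsFrom-swapHead : ∀ {i x y S} M → All (Outside x y) M → x ≤ y → (M ≡ [] → Q i) →
    AllDescentsFrom Q i (x ∷ M ++ y ∷ S) → AllDescentsFrom Q i (y ∷ M ++ x ∷ S)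
  allDescentsFrom-swapHead {S = S} [] [] x≤y adjacent (_ , ds) =
    (λ _ → adjacent refl) , allDescentsFrom-lowerHead S x≤y ds
  allDescentsFrom-swapHead (m ∷ M) os@(inj₁ m<x ∷ _) x≤y _ (d , ds) =
    (λ _ → d m<x) , allDescentsFrom-lowerAfter (m ∷ M) os x≤y ds
  allDescentsFrom-swapHead (m ∷ M) os@(inj₂ y<m ∷ _) x≤y _ (d , ds) =
    (λ m<y → contradiction y<m (<-asym m<y)) , allDescentsFrom-lowerAfter (m ∷ M) os x≤y ds

  allDescentsFrom-transpose : ∀ {i x y S} P M → All (Outside x y) M → x ≤ y →
    (M ≡ [] → Q (length P + i)) →
    AllDescentsFrom Q i (P ++ x ∷ M ++ y ∷ S) → AllDescentsFrom Q i (P ++ y ∷ M ++ x ∷ S)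
  allDescentsFrom-transpose [] M os x≤y adjacent ds =
    allDescentsFrom-swapHead M os x≤y adjacent ds
  allDescentsFrom-transpose (p ∷ []) M os x≤y adjacent (d , ds) =
    (λ y<p → d (≤-<-trans x≤y y<p)) , allDescentsFrom-transpose [] M os x≤y adjacent ds
  allDescentsFrom-transpose {i} (p ∷ p′ ∷ P) M os x≤y adjacent (d , ds) =
    d , allDescentsFrom-transpose (p′ ∷ P) M os x≤y
          (subst Q (sym (+-suc (length (p′ ∷ P)) i)) ∘ adjacent) ds

record TranspositionView (xs ys : List ℕ) (a b : ℕ) : Set where
  field
    P M S      : List ℕ
    x y        : ℕ
    before     : xs ≡ P ++ x ∷ M ++ y ∷ S
    after      : ys ≡ P ++ y ∷ M ++ x ∷ S
    length-P   : length P ≡ a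
    length-PxM : suc (length P + length M) ≡ b

update-split : ∀ {N} (v : Vec ℕ N) (b : Fin N) (z : ℕ) →
  Σ (List ℕ) λ M → Σ (List ℕ) λ S →
    (toList v ≡ M ++ lookup v b ∷ S) × (toList (v [ b ]≔ z) ≡ M ++ z ∷ S) × (length M ≡ toℕ b)
update-split (w ∷ᵥ ws) fzero    z = [] , toList ws , refl , refl , refl
update-split (w ∷ᵥ ws) (fsuc b) z with update-split ws b z
... | M , S , before , after , len =
  w ∷ M , S , cong (w ∷_) before , cong (w ∷_) after , cong suc len

swapPos-view : ∀ {N} (ρ : Perm N) (a b : Fin N) → toℕ a < toℕ b →
  TranspositionView (toList ρ) (toList (swapPos ρ a b)) (toℕ a) (toℕ b)
swapPos-view (w ∷ᵥ ws) fzero (fsuc b) _ with update-split ws b w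
... | M , S , before , after , len = record
  { P = [] ; M = M ; S = S ; x = w ; y = lookup ws b
  ; before = cong (w ∷_) before ; after = cong (lookup ws b ∷_) after
  ; length-P = refl ; length-PxM = cong suc len }
swapPos-view (w ∷ᵥ ws) (fsuc a) (fsuc b) (s≤s a<b) = record
  { P = w ∷ P ; M = M ; S = S ; x = x ; y = y
  ; before = cong (w ∷_) before ; after = cong (w ∷_) after
  ; length-P = cong suc length-P ; length-PxM = cong suc length-PxM }
  where open TranspositionView (swapPos-view ws a b a<b)

allDescents-cover : ∀ {Q : ℕ → Set} {N k} {ρ π : Perm N} →
  Cov k ρ π → Q k → AllDescents Q ρ → AllDescents Q π
allDescents-cover {Q} {k = k} {ρ} (a , b , a<k , k<b , refl , ℓ-suc) qk dρ =
  subst (AllDescentsFrom Q 1) (sym after)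
    (allDescentsFrom-transpose P M outside (<⇒≤ x<y) adjacent
      (subst (AllDescentsFrom Q 1) before dρ))
  where
  open TranspositionView (swapPos-view ρ a b (≤-trans a<k (s≤s⁻¹ k<b)))
  x<y×outside : x < y × All (Outside x y) M
  x<y×outside =
    transposition-cover P x M y S (subst₂ (λ u v → invList u ≡ suc (invList v)) after before ℓ-suc)
  x<y = proj₁ x<y×outside
  outside = proj₂ x<y×outside
  adjacent : M ≡ [] → Q (length P + 1)
  adjacent M≡[] = subst Q (≤-antisym k≤ ≤k) qk
    where
    k≤ : k ≤ length P + 1
    k≤ = subst (k ≤_) (begin
        toℕ b                        ≡⟨ sym length-PxM ⟩
        suc (length P + length M)    ≡⟨ cong (λ n → suc (length P + n)) (cong length M≡[]) ⟩
        suc (length P + 0)           ≡⟨ sym (+-suc (length P) 0) ⟩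
        length P + 1                 ∎) (s≤s⁻¹ k<b)
      where open ≡-Reasoning
    ≤k : length P + 1 ≤ k
    ≤k = subst (_≤ k) (trans (cong suc (sym length-P)) (+-comm 1 (length P))) a<k

allDescentsFrom-sorted : ∀ {Q : ℕ → Set} i {xs} → Linked _≤_ xs → AllDescentsFrom Q i xs
allDescentsFrom-sorted i []              = tt
allDescentsFrom-sorted i [-]             = tt
allDescentsFrom-sorted i (x≤y ∷ sorted) =
  (λ y<x → contradiction x≤y (<⇒≱ y<x)) , allDescentsFrom-sorted (suc i) sorted

tabulate-sorted : ∀ {N} (f : Fin N → ℕ) → (∀ i j → toℕ i ≤ toℕ j → f i ≤ f j) →
  Linked _≤_ (toList (tabulate f))
tabulate-sorted {zero}        f mono = []
tabulate-sorted {suc zero}    f mono = [-]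
tabulate-sorted {suc (suc N)} f mono =
  mono fzero (fsuc fzero) z≤n
    ∷ tabulate-sorted (f ∘ fsuc) (λ i j i≤j → mono (fsuc i) (fsuc j) (s≤s i≤j))

allDescents-id : ∀ {Q : ℕ → Set} N → AllDescents Q (idPerm N)
allDescents-id N = allDescentsFrom-sorted 1 (tabulate-sorted (suc ∘ toℕ) (λ _ _ → s≤s))

module _ {Q : ℕ → Set} {N} {π : Perm N} (dπ : AllDescents Q π) where

  allDescents-d₁ : ∀ d → d₁ π ≡ just d → Q d
  allDescents-d₁ d e =
    Maybe.drop-just (subst (Maybe.All Q) e (head⁺ (allDescentsFrom⇒All 1 (toList π) dπ)))

  allDescents-d₂ : ∀ d → d₂ π ≡ just d → Q d
  allDescents-d₂ d e =
    Maybe.drop-just (subst (Maybe.All Q) e (last⁺ (allDescentsFrom⇒All 1 (toList π) dπ)))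

module _ {N m n} (D : GrowthDiagram N m n) (Q : ℕ → Set) where
  open GrowthDiagram D

  allDescents-growthDiagram : ∀ {i j} → i ≤ m → j ≤ n →
    (∀ {j′} → j′ < j → Q (l (suc j′))) → (∀ {i′} → i′ < i → Q (k (suc i′))) →
    AllDescents Q (π i j)
  allDescents-growthDiagram {zero}  {zero}  _   _   _  _  =
    subst (AllDescents Q) (sym origin) (allDescents-id N)
  allDescents-growthDiagram {zero}  {suc j} _   j<n ql _  =
    allDescents-cover (horiz 0 j z≤n j<n) (ql (n<1+n j))
      (allDescents-growthDiagram z≤n (<⇒≤ j<n) (ql ∘ m<n⇒m<1+n) λ ())
  allDescents-growthDiagram {suc i} {j}     i<m j≤n ql qk =
    allDescents-cover (vert i j i<m j≤n) (qk (n<1+n i))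
      (allDescents-growthDiagram (<⇒≤ i<m) j≤n ql (qk ∘ m<n⇒m<1+n))

stepwise-monotone : ∀ {ℓ} (_∼_ : Rel ℕ ℓ) → Reflexive _∼_ → Transitive _∼_ →
  ∀ {m} (f : ℕ → ℕ) → (∀ i → 1 ≤ i → suc i ≤ m → f i ∼ f (suc i)) →
  ∀ {a b} → a ≤ b → suc b ≤ m → f (suc a) ∼ f (suc b)
stepwise-monotone _∼_ refl′ trans′ f step {b = zero}  z≤n   _   = refl′
stepwise-monotone _∼_ refl′ trans′ f step {b = suc b} a≤1+b b<m with m≤n⇒m<n∨m≡n a≤1+b
... | inj₂ refl      = refl′
... | inj₁ (s≤s a≤b) = trans′ {j = f (suc b)}
  (stepwise-monotone _∼_ refl′ trans′ f step a≤b (<⇒≤ b<m)) (step (suc b) (s≤s z≤n) b<m)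

corollary4p2 : (N m n : ℕ) (G : GrowthDiagram N m n) →
    let open GrowthDiagram G in
    (∀ i → 1 ≤ i → suc i ≤ m → k i ≤ k (suc i)) →
    (∀ j → 1 ≤ j → suc j ≤ n → l (suc j) ≤ l j) →
    (1 ≤ m → 1 ≤ n → l 1 ≤ k 1) →
    (∀ j i → suc j ≤ n → i ≤ m → l (suc j) ≤d₁ π i j)
    × (∀ i j → suc i ≤ m → j ≤ n → k (suc i) ≥d₂ π i j)
corollary4p2 N m n G k-step l-step l₁≤k₁ = descents-above , descents-below
  where
  open GrowthDiagram G

  k-mono : ∀ {a b} → a ≤ b → suc b ≤ m → k (suc a) ≤ k (suc b)
  k-mono = stepwise-monotone _≤_ ≤-refl ≤-trans k k-step

  l-anti : ∀ {a b} → a ≤ b → suc b ≤ n → l (suc b) ≤ l (suc a)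
  l-anti = stepwise-monotone (flip _≤_) ≤-refl (flip ≤-trans) l l-step

  l≤k : ∀ {a b} → suc a ≤ n → suc b ≤ m → l (suc a) ≤ k (suc b)
  l≤k a<n b<m = ≤-trans (l-anti z≤n a<n)
    (≤-trans (l₁≤k₁ (≤-trans (s≤s z≤n) b<m) (≤-trans (s≤s z≤n) a<n)) (k-mono z≤n b<m))

  descents-above : ∀ j i → suc j ≤ n → i ≤ m → l (suc j) ≤d₁ π i j
  descents-above j i j<n i≤m = allDescents-d₁
    (allDescents-growthDiagram G (l (suc j) ≤_) i≤m (<⇒≤ j<n)
      (λ j′<j → l-anti (<⇒≤ j′<j) j<n) (λ i′<i → l≤k j<n (≤-trans i′<i i≤m)))

  descents-below : ∀ i j → suc i ≤ m → j ≤ n → k (suc i) ≥d₂ π i j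
  descents-below i j i<m j≤n = allDescents-d₂
    (allDescents-growthDiagram G (_≤ k (suc i)) (<⇒≤ i<m) j≤n
      (λ j′<j → l≤k (≤-trans j′<j j≤n) i<m) (λ i′<i → k-mono (<⇒≤ i′<i) i<m))
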